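{- Let $T$ be a tree of radius three and let $G$ be a connected graph of order $n\ge 2$. (i) If $|C(T)|=2$, then $\dim_l(G\odot T)=2n$. (ii) If $C(T)=\{u\}$, then $\dim_l(G\odot T)=n(\varsigma(T)+1)$ if there exists $w\in N_T(u)$ with $h_w=1$, and $\dim_l(G\odot T)=n\cdot\varsigma(T)$ otherwise.
   Context: All graphs are finite and simple. For a connected graph $X$, $d_X(x,y)$ is the length of a shortest path between $x$ and $y$. A vertex $w$ distinguishes two vertices $x,y$ if $d_X(w,x)\ne d_X(w,y)$. A set $S\subseteq V(X)$ is a local metric generator for $X$ if every two adjacent vertices of $X$ are distinguished by some vertex of $S$; a local metric generator of minimum cardinality is a local metric basis, and its cardinality is the local metric dimension $\dim_l(X)$. For a graph $G$ of order $n$ with vertices $v_1,\dots,v_n$ and a graph $H$, the corona product $G\odot H$ is obtained from one copy of $G$ and $n$ disjoint copies $H_1,\dots,H_n$ of $H$ by joining $v_i$ by an edge to every vertex of $H_i$. The center $C(T)$ is the set of vertices of $T$ of eccentricity equal to the radius. When $C(T)=\{u\}$: removing $u$ from $T$ yields, for each $w\in N_T(u)$, a rooted tree $T_w=(V_w,E_w)$ with root $w$ (the component containing $w$); its height is $h_w=\max_{x\in V_w} d(w,x)$; and $\varsigma(T)=|\{w\in N_T(u): h_w=2\}|$. -}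

module Defs where

open import Data.Nat using (ℕ; zero; suc; _+_; _*_; _≤_; _<_)
open import Data.Fin using (Fin; splitAt; remQuot)
open import Data.Fin.Subset using (Subset; _∈_; ∣_∣)
open import Data.Sum using (_⊎_; inj₁; inj₂)
open import Data.Product using (Σ; ∃; ∃-syntax; _×_; _,_; proj₁; proj₂)
open import Data.Maybe using (just)
open import Data.List using (List; _∷_; length; last)
open import Data.List.Relation.Unary.Unique.Propositional using (Unique)
open import Data.List.Relation.Unary.Linked using (Linked)
open import Relation.Nullary using (¬_)
open import Relation.Binary.PropositionalEquality using (_≡_; _≢_; refl; sym)
open import Function using (_⇔_)

record Graph (N : ℕ) : Set₁ where
  field
    Adj    : Fin N → Fin N → Set
    adj-sym : ∀ {x y} → Adj x y → Adj y x
    adj-irrefl : ∀ {x} → ¬ Adj x x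
open Graph public

data Walk {N : ℕ} (R : Fin N → Fin N → Set) : Fin N → Fin N → ℕ → Set where
  here  : ∀ {x} → Walk R x x 0
  there : ∀ {x z y k} → R x z → Walk R z y k → Walk R x y (suc k)

DistR : ∀ {N} → (Fin N → Fin N → Set) → Fin N → Fin N → ℕ → Set
DistR R x y k = Walk R x y k × (∀ j → j < k → ¬ Walk R x y j)

Dist : ∀ {N} → Graph N → Fin N → Fin N → ℕ → Set
Dist G = DistR (Adj G)

Connected : ∀ {N} → Graph N → Set
Connected G = ∀ x y → ∃[ k ] Walk (Adj G) x y k

Cycle : ∀ {N} → Graph N → Set
Cycle {N} G = Σ (Fin N) λ v → Σ (List (Fin N)) λ vs →
  (2 ≤ length vs) × Unique (v ∷ vs) × Linked (Adj G) (v ∷ vs) ×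
  (∃[ z ] (last vs ≡ just z × Adj G z v))

Acyclic : ∀ {N} → Graph N → Set
Acyclic G = ¬ Cycle G

IsTree : ∀ {N} → Graph N → Set
IsTree G = Connected G × Acyclic G

Ecc : ∀ {N} → Graph N → Fin N → ℕ → Set
Ecc G x e = (∀ y k → Dist G x y k → k ≤ e) × ∃[ y ] Dist G x y e

Radius : ∀ {N} → Graph N → ℕ → Set
Radius G r = (∃[ x ] Ecc G x r) × (∀ x e → Ecc G x e → r ≤ e)

Central : ∀ {N} → Graph N → Fin N → Set
Central G x = ∃[ r ] (Radius G r × Ecc G x r)

CenterHasTwo : ∀ {N} → Graph N → Set
CenterHasTwo {N} G = Σ (Fin N) λ a → Σ (Fin N) λ b →
  a ≢ b × Central G a × Central G b × (∀ x → Central G x → x ≡ a ⊎ x ≡ b)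

CenterIs : ∀ {N} → Graph N → Fin N → Set
CenterIs G u = Central G u × (∀ x → Central G x → x ≡ u)

AdjWithout : ∀ {N} → Graph N → Fin N → Fin N → Fin N → Set
AdjWithout G u x y = Adj G x y × x ≢ u × y ≢ u

-- h_w = h : height of the rooted tree T_w (the component of T - u containing w),
-- i.e. max over x ∈ V_w of the distance from w to x (distance within T_w).
Height : ∀ {N} → Graph N → Fin N → Fin N → ℕ → Set
Height G u w h =
  (∀ x k → DistR (AdjWithout G u) w x k → k ≤ h) × ∃[ x ] DistR (AdjWithout G u) w x h

Varsigma : ∀ {N} → Graph N → Fin N → ℕ → Set
Varsigma {N} G u s = Σ (Subset N) λ S →
  (∀ w → (w ∈ S) ⇔ (Adj G u w × Height G u w 2)) × ∣ S ∣ ≡ s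

Distinguishes : ∀ {N} → Graph N → Fin N → Fin N → Fin N → Set
Distinguishes G w x y = ∃[ k₁ ] ∃[ k₂ ] (Dist G w x k₁ × Dist G w y k₂ × k₁ ≢ k₂)

IsLocalMetricGenerator : ∀ {N} → Graph N → Subset N → Set
IsLocalMetricGenerator {N} G S =
  ∀ x y → Adj G x y → ∃[ w ] (w ∈ S × Distinguishes G w x y)

LocalMetricDim : ∀ {N} → Graph N → ℕ → Set
LocalMetricDim {N} G d =
  (∃[ S ] (IsLocalMetricGenerator G S × ∣ S ∣ ≡ d)) ×
  (∀ S → IsLocalMetricGenerator G S → d ≤ ∣ S ∣)

-- Corona product G ⊙ H.  Vertex set Fin n ⊎ (Fin n × Fin m), where inj₁ i is
-- v_i of G and inj₂ (i , h) is vertex h of the copy H_i.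
CoronaAdj' : ∀ {n m} → Graph n → Graph m →
  Fin n ⊎ (Fin n × Fin m) → Fin n ⊎ (Fin n × Fin m) → Set
CoronaAdj' G H (inj₁ i) (inj₁ j) = Adj G i j
CoronaAdj' G H (inj₁ i) (inj₂ (k , h)) = i ≡ k
CoronaAdj' G H (inj₂ (k , h)) (inj₁ i) = i ≡ k
CoronaAdj' G H (inj₂ (k , h)) (inj₂ (k' , h')) = k ≡ k' × Adj H h h'

coronaSym : ∀ {n m} (G : Graph n) (H : Graph m) {a b} →
  CoronaAdj' G H a b → CoronaAdj' G H b a
coronaSym G H {inj₁ i} {inj₁ j} p = Graph.adj-sym G p
coronaSym G H {inj₁ i} {inj₂ _} p = p
coronaSym G H {inj₂ _} {inj₁ i} p = p
coronaSym G H {inj₂ _} {inj₂ _} (e , p) = sym e , Graph.adj-sym H p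

coronaIrrefl : ∀ {n m} (G : Graph n) (H : Graph m) {a} → ¬ CoronaAdj' G H a a
coronaIrrefl G H {inj₁ i} p = Graph.adj-irrefl G p
coronaIrrefl G H {inj₂ _} (_ , p) = Graph.adj-irrefl H p

-- Bijection Fin (n + n * m) ≃ Fin n ⊎ (Fin n × Fin m) (splitAt, remQuot).
coronaView : ∀ {n m} → Fin (n + n * m) → Fin n ⊎ (Fin n × Fin m)
coronaView {n} {m} x with splitAt n x
... | inj₁ i = inj₁ i
... | inj₂ j = inj₂ (remQuot m j)

corona : ∀ {n m} → Graph n → Graph m → Graph (n + n * m)
corona G H = record
  { Adj    = λ x y → CoronaAdj' G H (coronaView x) (coronaView y)
  ; adj-sym    = λ {x} {y} → coronaSym G H {coronaView x} {coronaView y}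
  ; adj-irrefl = λ {x} → coronaIrrefl G H {coronaView x}
  }

-- In G ⊙ T a vertex outside the copy T_i reaches T_i only through v_i, so it sees both ends of
-- an edge xy of T_i at the same distance; a vertex s of T_i sees them at distances in {0, 1, 2}
-- and, T having no triangles, distinguishes them exactly when s ∈ N[x] ∪ N[y]. Edges of G and
-- edges v_i x are distinguished by any vertex of a neighbouring copy. Hence dim_l(G ⊙ T) = n k,
-- with k the least size of a set meeting N[x] ∪ N[y] for every edge xy of T.
--
-- Root T at a centre, of eccentricity three. An edge between depths three and two sees only its
-- own branch, so distinct such branches need distinct vertices, and the branch root serves them
-- all. If |C(T)| = 2, every vertex at depth three hangs below the other centre b, and {a, b} is
-- optimal since the deepest edges seen from a and from b lie in disjoint branches. If C(T) = {u},
-- the roots of the branches of height two suffice, unless some branch has height one: its leaf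
-- edges see only that branch and u.

module Submission where

open import Data.Empty using (⊥; ⊥-elim)
open import Data.Fin using (Fin; zero; suc; _↑ˡ_; _↑ʳ_; splitAt; join; combine; remQuot)
  renaming (_≟_ to _≟F_)
open import Data.Fin.Properties
  using (any?; splitAt-↑ˡ; splitAt-↑ʳ; join-splitAt; remQuot-combine; combine-remQuot)
open import Data.Fin.Subset using (Subset; _∈_; _∉_; ∣_∣; ⁅_⁆; _∪_; inside; outside) renaming (⊥ to ∅)
open import Data.Fin.Subset.Properties
  using (∪-identityˡ; ∣⁅x⁆∣≡1; ∣⊥∣≡0; x∈p∪q⁺; x∈p∪q⁻; x∈⁅x⁆; x∈⁅y⁆⇒x≡y; p⊆q⇒∣p∣≤∣q∣; _∈?_)
open import Data.List using (List; []; _∷_; _++_; length; reverse; last; drop; allFin)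
open import Data.List.Extrema.Nat using (argmax; f[xs]≤f[argmax])
open import Data.List.Membership.Propositional using () renaming (_∈_ to _∈ₗ_; _∉_ to _∉ₗ_)
open import Data.List.Membership.Propositional.Properties using (∈-∃++; ∈-++⁻; ∈-++⁺ʳ; ∈-allFin)
open import Data.List.Properties using (unfold-reverse; length-reverse; length-++; ∷-injectiveʳ)
open import Data.List.Relation.Unary.All using ([]; _∷_) renaming (lookup to All-lookup)
open import Data.List.Relation.Unary.All.Properties using (¬Any⇒All¬; All¬⇒¬Any; ++⁻ʳ)
open import Data.List.Relation.Unary.AllPairs using ([]; _∷_)
open import Data.List.Relation.Unary.Any using (here; there)
open import Data.List.Relation.Unary.Any.Properties using () renaming (reverse⁻ to ∈-reverse⁻)
open import Data.List.Relation.Unary.Linked using (Linked; [-]; _∷_)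
open import Data.List.Relation.Unary.Unique.Propositional using (Unique)
open import Data.Maybe using (just)
open import Data.Nat using (ℕ; zero; suc; _+_; _*_; _≤_; _<_; z≤n; s≤s; pred; ≢-nonZero)
open import Data.Nat.Properties
open import Data.Product using (∃; ∃₂; ∃-syntax; _×_; _,_; proj₁; proj₂)
open import Data.Sum using (_⊎_; inj₁; inj₂)
open import Data.Vec using (Vec; []; _∷_; here; there; concat; lookup; replicate; group)
  renaming (_++_ to _++ᵛ_; splitAt to splitAtᵛ)
open import Data.Vec.Properties using (lookup-++ʳ; lookup-concat; lookup-replicate; []=⇒lookup; lookup⇒[]=)
open import Function using (_⇔_; Equivalence)
open import Relation.Binary.PropositionalEquality
  using (_≡_; _≢_; refl; sym; trans; cong; cong₂; subst; subst₂; module ≡-Reasoning)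
open import Relation.Nullary using (¬_; yes; no)
open import Relation.Nullary.Decidable using (_×-dec_; decidable-stable)

open import Defs

module _ {N} {R : Fin N → Fin N → Set} where

  walk-snoc : ∀ {x y z k} → Walk R x y k → R y z → Walk R x z (suc k)
  walk-snoc here r = there r here
  walk-snoc (there r′ w) r = there r′ (walk-snoc w r)

  walk-zero : ∀ {x y} → Walk R x y 0 → x ≡ y
  walk-zero here = refl

  walk-first-step : ∀ {x y k} → Walk R x y k → x ≢ y → ∃ (R x)
  walk-first-step here x≢y = ⊥-elim (x≢y refl)
  walk-first-step (there r _) _ = _ , r

  DistR-≤-walk : ∀ {x y k l} → DistR R x y k → Walk R x y l → k ≤ l
  DistR-≤-walk (_ , shortest) w = ≮⇒≥ (λ l<k → shortest _ l<k w)

walk-map : ∀ {N} {R S : Fin N → Fin N → Set} → (∀ {x y} → R x y → S x y) →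
           ∀ {x y k} → Walk R x y k → Walk S x y k
walk-map f here = here
walk-map f (there r w) = there (f r) (walk-map f w)

has-neighbour : ∀ {n} (G : Graph n) → Connected G → 2 ≤ n → ∀ i → ∃ (Adj G i)
has-neighbour G connected 2≤n i = walk-first-step (proj₂ (connected i (other 2≤n i))) (other-≢ 2≤n i)
  where
  other : ∀ {n} → 2 ≤ n → Fin n → Fin n
  other (s≤s (s≤s _)) zero = suc zero
  other (s≤s (s≤s _)) (suc _) = zero
  other-≢ : ∀ {n} (2≤n : 2 ≤ n) i → i ≢ other 2≤n i
  other-≢ (s≤s (s≤s _)) zero ()
  other-≢ (s≤s (s≤s _)) (suc _) ()

TriangleFree : ∀ {m} → Graph m → Set
TriangleFree T = ∀ {a b c} → Adj T a b → Adj T b c → Adj T c a → ⊥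

central⇒Ecc : ∀ {N} {G : Graph N} {r x} → Radius G r → Central G x → Ecc G x r
central⇒Ecc {G = G} {x = x} rad (r′ , rad′ , ecc′) = subst (Ecc G x) (≤-antisym r′≤r r≤r′) ecc′
  where
  r′≤r = proj₂ rad′ _ _ (proj₂ (proj₁ rad))
  r≤r′ = proj₂ rad _ _ (proj₂ (proj₁ rad′))

Height-unique : ∀ {N} {G : Graph N} {u w h h′} → Height G u w h → Height G u w h′ → h ≡ h′
Height-unique (bound , x , d) (bound′ , x′ , d′) = ≤-antisym (bound′ x _ d) (bound x′ _ d′)

-- Cardinalities of finite subsets

∣⁅x⁆∪p∣≤1+∣p∣ : ∀ {N} (x : Fin N) (p : Subset N) → ∣ ⁅ x ⁆ ∪ p ∣ ≤ suc ∣ p ∣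
∣⁅x⁆∪p∣≤1+∣p∣ zero (inside ∷ p) rewrite ∪-identityˡ p = n≤1+n _
∣⁅x⁆∪p∣≤1+∣p∣ zero (outside ∷ p) rewrite ∪-identityˡ p = ≤-refl
∣⁅x⁆∪p∣≤1+∣p∣ (suc x) (inside ∷ p) = s≤s (∣⁅x⁆∪p∣≤1+∣p∣ x p)
∣⁅x⁆∪p∣≤1+∣p∣ (suc x) (outside ∷ p) = ∣⁅x⁆∪p∣≤1+∣p∣ x p

x∉p⇒∣⁅x⁆∪p∣≡1+∣p∣ : ∀ {N} (x : Fin N) (p : Subset N) → x ∉ p → ∣ ⁅ x ⁆ ∪ p ∣ ≡ suc ∣ p ∣
x∉p⇒∣⁅x⁆∪p∣≡1+∣p∣ zero (inside ∷ p) x∉ = ⊥-elim (x∉ here)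
x∉p⇒∣⁅x⁆∪p∣≡1+∣p∣ zero (outside ∷ p) _ rewrite ∪-identityˡ p = refl
x∉p⇒∣⁅x⁆∪p∣≡1+∣p∣ (suc x) (inside ∷ p) x∉ =
  cong suc (x∉p⇒∣⁅x⁆∪p∣≡1+∣p∣ x p (λ x∈ → x∉ (there x∈)))
x∉p⇒∣⁅x⁆∪p∣≡1+∣p∣ (suc x) (outside ∷ p) x∉ = x∉p⇒∣⁅x⁆∪p∣≡1+∣p∣ x p (λ x∈ → x∉ (there x∈))

∈⁅x⁆∪p⁻ : ∀ {N} (x : Fin N) (p : Subset N) {w} → w ∈ ⁅ x ⁆ ∪ p → w ≡ x ⊎ w ∈ p
∈⁅x⁆∪p⁻ x p w∈ with x∈p∪q⁻ ⁅ x ⁆ p w∈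
... | inj₁ w∈⁅x⁆ = inj₁ (x∈⁅y⁆⇒x≡y x w∈⁅x⁆)
... | inj₂ w∈p = inj₂ w∈p

x≢y⇒∣⁅x⁆∪⁅y⁆∣≡2 : ∀ {N} {x y : Fin N} → x ≢ y → ∣ ⁅ x ⁆ ∪ ⁅ y ⁆ ∣ ≡ 2
x≢y⇒∣⁅x⁆∪⁅y⁆∣≡2 {y = y} x≢y =
  trans (x∉p⇒∣⁅x⁆∪p∣≡1+∣p∣ _ ⁅ y ⁆ (λ x∈ → x≢y (x∈⁅y⁆⇒x≡y y x∈))) (cong suc (∣⁅x⁆∣≡1 y))

image : ∀ {k N} → (Fin k → Fin N) → Subset k → Subset N
image {zero} g [] = ∅
image {suc k} g (inside ∷ q) = ⁅ g zero ⁆ ∪ image (λ t → g (suc t)) q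
image {suc k} g (outside ∷ q) = image (λ t → g (suc t)) q

∈-image : ∀ {k N} (g : Fin k → Fin N) (q : Subset k) {t} → t ∈ q → g t ∈ image g q
∈-image g (inside ∷ q) here = x∈p∪q⁺ (inj₁ (x∈⁅x⁆ _))
∈-image g (inside ∷ q) (there t∈) = x∈p∪q⁺ (inj₂ (∈-image (λ t → g (suc t)) q t∈))
∈-image g (outside ∷ q) (there t∈) = ∈-image (λ t → g (suc t)) q t∈

∣image∣≤ : ∀ {k N} (g : Fin k → Fin N) (q : Subset k) → ∣ image g q ∣ ≤ ∣ q ∣
∣image∣≤ {zero} {N} g [] = ≤-reflexive (∣⊥∣≡0 N)
∣image∣≤ g (inside ∷ q) = ≤-trans (∣⁅x⁆∪p∣≤1+∣p∣ (g zero) _) (s≤s (∣image∣≤ (λ t → g (suc t)) q))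
∣image∣≤ g (outside ∷ q) = ∣image∣≤ (λ t → g (suc t)) q

⊆-image⇒∣p∣≤∣q∣ : ∀ {k N} (g : Fin k → Fin N) (p : Subset N) (q : Subset k) →
                   (∀ w → w ∈ p → ∃ λ t → t ∈ q × g t ≡ w) → ∣ p ∣ ≤ ∣ q ∣
⊆-image⇒∣p∣≤∣q∣ g p q p⊆ = ≤-trans (p⊆q⇒∣p∣≤∣q∣ p⊆image) (∣image∣≤ g q)
  where
  p⊆image : ∀ {w} → w ∈ p → w ∈ image g q
  p⊆image {w} w∈ with p⊆ w w∈
  ... | t , t∈ , refl = ∈-image g q t∈

∣p++q∣ : ∀ {k l} (p : Subset k) (q : Subset l) → ∣ p ++ᵛ q ∣ ≡ ∣ p ∣ + ∣ q ∣
∣p++q∣ [] q = refl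
∣p++q∣ (inside ∷ p) q = cong suc (∣p++q∣ p q)
∣p++q∣ (outside ∷ p) q = ∣p++q∣ p q

totalSize : ∀ {m k} → Vec (Subset m) k → ℕ
totalSize [] = 0
totalSize (p ∷ ps) = ∣ p ∣ + totalSize ps

∣concat∣ : ∀ {m k} (ps : Vec (Subset m) k) → ∣ concat ps ∣ ≡ totalSize ps
∣concat∣ [] = refl
∣concat∣ (p ∷ ps) = trans (∣p++q∣ p (concat ps)) (cong (∣ p ∣ +_) (∣concat∣ ps))

totalSize-replicate : ∀ {m} k (p : Subset m) → totalSize (replicate k p) ≡ k * ∣ p ∣
totalSize-replicate zero p = refl
totalSize-replicate (suc k) p = cong (∣ p ∣ +_) (totalSize-replicate k p)

totalSize-≥ : ∀ {m k} c (ps : Vec (Subset m) k) → (∀ i → c ≤ ∣ lookup ps i ∣) → k * c ≤ totalSize ps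
totalSize-≥ c [] _ = z≤n
totalSize-≥ c (p ∷ ps) c≤ = +-mono-≤ (c≤ zero) (totalSize-≥ c ps (λ i → c≤ (suc i)))

-- Edge covers

Near : ∀ {m} → Graph m → Fin m → Fin m → Fin m → Set
Near T s x y = s ≡ x ⊎ s ≡ y ⊎ Adj T s x ⊎ Adj T s y

Near-swap : ∀ {m} {T : Graph m} {s x y} → Near T s x y → Near T s y x
Near-swap (inj₁ e) = inj₂ (inj₁ e)
Near-swap (inj₂ (inj₁ e)) = inj₁ e
Near-swap (inj₂ (inj₂ (inj₁ a))) = inj₂ (inj₂ (inj₂ a))
Near-swap (inj₂ (inj₂ (inj₂ a))) = inj₂ (inj₂ (inj₁ a))

EdgeCover : ∀ {m} → Graph m → Subset m → Set
EdgeCover T S = ∀ x y → Adj T x y → ∃ λ s → s ∈ S × Near T s x y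

-- Adjacency is not decidable, so a local metric generator of a corona only
-- yields this double-negated form of a cover in each copy.
WeakEdgeCover : ∀ {m} → Graph m → Subset m → Set
WeakEdgeCover T S = ∀ x y → Adj T x y → ¬ ¬ (∃ λ s → s ∈ S × Near T s x y)

-- The cover is nonempty: one of its vertices distinguishes the edges of G in the corona.
EdgeCoverNumber : ∀ {m} → Graph m → ℕ → Set
EdgeCoverNumber T k =
  (∃ λ S → EdgeCover T S × ∣ S ∣ ≡ k × ∃ λ s → s ∈ S) ×
  (∀ S → WeakEdgeCover T S → k ≤ ∣ S ∣)

EdgeMappedTo : ∀ {m} → Graph m → (Fin m → Fin m) → Fin m → Set
EdgeMappedTo T g w = ∃₂ λ x y → Adj T x y × (∀ t → Near T t x y → g t ≡ w)

-- The near vertices of the edges mapped to distinct w lie in disjoint fibres of g.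
weak-cover-≥ : ∀ {m} {T : Graph m} (g : Fin m → Fin m) (P : Subset m) →
               (∀ w → w ∈ P → EdgeMappedTo T g w) → ∀ S → WeakEdgeCover T S → ∣ P ∣ ≤ ∣ S ∣
weak-cover-≥ g P mapped S cover = ⊆-image⇒∣p∣≤∣q∣ g P S hit
  where
  hit : ∀ w → w ∈ P → ∃ λ t → t ∈ S × g t ≡ w
  hit w w∈ with mapped w w∈
  ... | x , y , a , to-w = decidable-stable (any? (λ t → (t ∈? S) ×-dec (g t ≟F w)))
                             (λ ∄t → cover x y a (λ { (t , t∈ , near) → ∄t (t , t∈ , to-w t near) }))

module VertexPaths {m} (T : Graph m) where

  open import Data.List.Membership.DecPropositional (_≟F_ {m}) using () renaming (_∈?_ to _∈ₗ?_)

  data Path : Fin m → Fin m → List (Fin m) → Set where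
    nil  : ∀ {x} → Path x x (x ∷ [])
    cons : ∀ {x y z vs} → Adj T x y → Path y z vs → Path x z (x ∷ vs)

  steps : ∀ {x z vs} → Path x z vs → ℕ
  steps nil = 0
  steps (cons _ p) = suc (steps p)

  length-vertices : ∀ {x z vs} (p : Path x z vs) → length vs ≡ suc (steps p)
  length-vertices nil = refl
  length-vertices (cons _ p) = cong suc (length-vertices p)

  head-vertex : ∀ {x z y vs} → Path x z (y ∷ vs) → x ≡ y
  head-vertex nil = refl
  head-vertex (cons _ _) = refl

  vertices-nonempty : ∀ {x z vs} → Path x z vs → vs ≢ []
  vertices-nonempty nil ()
  vertices-nonempty (cons _ _) ()

  target∈ : ∀ {x z vs} → Path x z vs → z ∈ₗ vs
  target∈ nil = here refl
  target∈ (cons _ p) = there (target∈ p)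

  path-linked : ∀ {x z vs} → Path x z vs → Linked (Adj T) vs
  path-linked nil = [-]
  path-linked (cons r nil) = r ∷ [-]
  path-linked (cons r (cons r′ p)) = r ∷ path-linked (cons r′ p)

  path-last : ∀ {x z vs} → Path x z vs → last vs ≡ just z
  path-last nil = refl
  path-last (cons r nil) = refl
  path-last (cons r (cons r′ p)) = path-last (cons r′ p)

  toWalk : ∀ {x z vs} (p : Path x z vs) → Walk (Adj T) x z (steps p)
  toWalk nil = here
  toWalk (cons r p) = there r (toWalk p)

  fromWalk : ∀ {x z k} → Walk (Adj T) x z k → ∃₂ λ vs (p : Path x z vs) → steps p ≡ k
  fromWalk here = _ , nil , refl
  fromWalk (there r w) with fromWalk w
  ... | _ , p , refl = _ , cons r p , refl

  _++ₚ_ : ∀ {x y z vs ws} → Path x y vs → Path y z ws → Path x z (vs ++ drop 1 ws)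
  nil ++ₚ nil = nil
  nil ++ₚ cons r q = cons r q
  cons r p ++ₚ q = cons r (p ++ₚ q)

  reverseₚ : ∀ {x z vs} → Path x z vs → Path z x (reverse vs)
  reverseₚ nil = nil
  reverseₚ {x} (cons {vs = vs} r p) =
    subst (Path _ _) (sym (unfold-reverse x vs)) (reverseₚ p ++ₚ cons (adj-sym T r) nil)

  suffix : ∀ {x z vs} pre {v suf} → Path x z vs → vs ≡ pre ++ v ∷ suf → Path v z (v ∷ suf)
  suffix [] nil refl = nil
  suffix [] (cons r p) refl = cons r p
  suffix (_ ∷ []) nil ()
  suffix (_ ∷ _ ∷ _) nil ()
  suffix (_ ∷ pre) (cons r p) refl = suffix pre p refl

  unique-suffix : ∀ (pre : List (Fin m)) {vs} → Unique (pre ++ vs) → Unique vs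
  unique-suffix [] u = u
  unique-suffix (_ ∷ pre) (_ ∷ u) = unique-suffix pre u

  SimplePathWithin : Fin m → Fin m → List (Fin m) → Set
  SimplePathWithin x z vs = ∃ λ us → Path x z us × Unique us ×
                            (∀ {v} → v ∈ₗ us → v ∈ₗ vs) × length us ≤ length vs

  erase-loops : ∀ {x z vs} → Path x z vs → SimplePathWithin x z vs
  erase-loops nil = _ , nil , [] ∷ [] , (λ v∈ → v∈) , ≤-refl
  erase-loops {x} (cons r p) with erase-loops p
  ... | us , q , u , sub , len with x ∈ₗ? us
  ...   | no x∉ = x ∷ us , cons r q , ¬Any⇒All¬ us x∉ ∷ u ,
                 (λ { (here e) → here e ; (there v∈) → there (sub v∈) }) , s≤s len
  ...   | yes x∈ with ∈-∃++ x∈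
  ...     | pre , suf , refl =
            x ∷ suf , suffix pre q refl , unique-suffix pre u ,
            (λ v∈ → there (sub (∈-++⁺ʳ pre v∈))) ,
            ≤-trans (subst (suc (length suf) ≤_) (sym (length-++ pre)) (m≤n+m _ (length pre)))
                    (≤-trans len (n≤1+n _))

-- Trees

module Tree {m} (T : Graph m) (tree : IsTree T) where

  open VertexPaths T public

  adj-≢ : ∀ {x y} → Adj T x y → x ≢ y
  adj-≢ a refl = adj-irrefl T a

  triangle-free : TriangleFree T
  triangle-free {a} {b} {c} ab bc ca =
    proj₂ tree (a , b ∷ c ∷ [] , s≤s (s≤s z≤n) ,
      ((adj-≢ ab ∷ (λ e → adj-≢ ca (sym e)) ∷ []) ∷ (adj-≢ bc ∷ []) ∷ [] ∷ []) ,
      ab ∷ bc ∷ [-] , (c , refl , ca))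

  no-path-avoiding-common-neighbour : ∀ {x p q vs} → Adj T x p → Adj T x q → p ≢ q →
                                   Path p q vs → x ∉ₗ vs → ⊥
  no-path-avoiding-common-neighbour {x} xp xq p≢q p x∉ with erase-loops p
  ... | _ , nil , _ = p≢q refl
  ... | us , cons r q , u , sub , _ =
    proj₂ tree (x , us , s≤s (subst (1 ≤_) (sym (length-vertices q)) (s≤s z≤n)) ,
                (¬Any⇒All¬ us (λ x∈ → x∉ (sub x∈)) ∷ u) ,
                xp ∷ path-linked (cons r q) , (_ , path-last (cons r q) , adj-sym T xq))

  simple-paths-equal : ∀ {x z vs ws} → Path x z vs → Unique vs → Path x z ws → Unique ws → vs ≡ ws
  simple-paths-equal nil _ nil _ = refl
  simple-paths-equal nil _ (cons _ p) (x∉ ∷ _) = ⊥-elim (All¬⇒¬Any x∉ (target∈ p))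
  simple-paths-equal (cons _ p) (x∉ ∷ _) nil _ = ⊥-elim (All¬⇒¬Any x∉ (target∈ p))
  simple-paths-equal {x} (cons {y = y₁} {vs = vs₁} r₁ p₁) (x∉₁ ∷ u₁)
                         (cons {y = y₂} {vs = vs₂} r₂ p₂) (x∉₂ ∷ u₂) with y₁ ≟F y₂
  ... | yes refl = cong (x ∷_) (simple-paths-equal p₁ u₁ p₂ u₂)
  ... | no y₁≢y₂ = ⊥-elim (no-path-avoiding-common-neighbour r₁ r₂ y₁≢y₂ (p₁ ++ₚ reverseₚ p₂) x∉)
    where
    x∉ : x ∉ₗ vs₁ ++ drop 1 (reverse vs₂)
    x∉ x∈ with ∈-++⁻ vs₁ x∈
    ... | inj₁ x∈₁ = All¬⇒¬Any x∉₁ x∈₁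
    ... | inj₂ x∈₂ = All¬⇒¬Any x∉₂ (∈-reverse⁻ (∈-drop-1 x∈₂))
      where
      ∈-drop-1 : ∀ {v vs} → v ∈ₗ drop 1 vs → v ∈ₗ vs
      ∈-drop-1 {vs = _ ∷ _} v∈ = there v∈

  module Rooted (r : Fin m) where

    open import Data.List.Membership.DecPropositional (_≟F_ {m}) using () renaming (_∈?_ to _∈ₗ?_)

    private
      geodesic : ∀ z → ∃ λ vs → Path z r vs × Unique vs
      geodesic z with fromWalk (proj₂ (proj₁ tree z r))
      ... | _ , p , _ with erase-loops p
      ...   | us , q , u , _ = us , q , u

    pathTo : Fin m → List (Fin m)
    pathTo z = proj₁ (geodesic z)

    pathTo-path : ∀ z → Path z r (pathTo z)
    pathTo-path z = proj₁ (proj₂ (geodesic z))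

    pathTo-unique : ∀ z → Unique (pathTo z)
    pathTo-unique z = proj₂ (proj₂ (geodesic z))

    pathTo-canonical : ∀ {z vs} → Path z r vs → Unique vs → vs ≡ pathTo z
    pathTo-canonical p u = simple-paths-equal p u (pathTo-path _) (pathTo-unique _)

    depth : Fin m → ℕ
    depth z = steps (pathTo-path z)

    length-pathTo : ∀ z → length (pathTo z) ≡ suc (depth z)
    length-pathTo z = length-vertices (pathTo-path z)

    depth-≤-path : ∀ {z vs} → Path z r vs → suc (depth z) ≤ length vs
    depth-≤-path p with erase-loops p
    ... | _ , q , u , _ , len =
      subst (_≤ _) (trans (cong length (pathTo-canonical q u)) (length-pathTo _)) len

    depth-≤-walk-to-root : ∀ {z k} → Walk (Adj T) z r k → depth z ≤ k
    depth-≤-walk-to-root w with fromWalk w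
    ... | _ , p , refl = ≤-pred (subst (_ ≤_) (length-vertices p) (depth-≤-path p))

    steps-reverse : ∀ {x z vs} (p : Path x z vs) → steps (reverseₚ p) ≡ steps p
    steps-reverse {vs = vs} p = suc-injective
      (trans (sym (length-vertices (reverseₚ p))) (trans (length-reverse vs) (length-vertices p)))

    depth-≤-walk-from-root : ∀ {z k} → Walk (Adj T) r z k → depth z ≤ k
    depth-≤-walk-from-root w with fromWalk w
    ... | _ , p , refl = subst (depth _ ≤_) (steps-reverse p) (depth-≤-walk-to-root (toWalk (reverseₚ p)))

    dist-depth : ∀ z → Dist T r z (depth z)
    dist-depth z = subst (Walk (Adj T) r z) (steps-reverse (pathTo-path z)) (toWalk (reverseₚ (pathTo-path z))) ,
                   λ j j< w → <⇒≱ j< (depth-≤-walk-from-root w)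

    dist-root-unique : ∀ {z k} → Dist T r z k → k ≡ depth z
    dist-root-unique d = ≤-antisym (DistR-≤-walk d (proj₁ (dist-depth _))) (depth-≤-walk-from-root (proj₁ d))

    ChildOf : Fin m → Fin m → Set
    ChildOf x y = pathTo x ≡ x ∷ pathTo y

    adjacent-child : ∀ {x y} → Adj T x y → ChildOf y x ⊎ ChildOf x y
    adjacent-child {x} {y} a with y ∈ₗ? pathTo x
    ... | no y∉ = inj₁ (sym (pathTo-canonical (cons (adj-sym T a) (pathTo-path x))
                                              (¬Any⇒All¬ _ y∉ ∷ pathTo-unique x)))
    ... | yes y∈ with ∈-∃++ y∈
    ...   | pre , suf , split = inj₂ (x-child pre split)
      where
      y-path : Path y r (y ∷ suf)
      y-path = suffix pre (pathTo-path x) split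
      y-unique : Unique (y ∷ suf)
      y-unique = unique-suffix pre (subst Unique split (pathTo-unique x))
      x-child : ∀ pre′ → pathTo x ≡ pre′ ++ y ∷ suf → ChildOf x y
      x-child [] split′ = ⊥-elim (adj-≢ a (head-vertex (subst (Path x r) split′ (pathTo-path x))))
      x-child (_ ∷ pre′) split′
        with head-vertex (subst (Path x r) split′ (pathTo-path x)) | subst Unique split′ (pathTo-unique x)
      ... | refl | x∉ ∷ _ = trans (sym (pathTo-canonical (cons a y-path) (++⁻ʳ pre′ x∉ ∷ y-unique)))
                                 (cong (x ∷_) (pathTo-canonical y-path y-unique))

    depth-child : ∀ {x y} → ChildOf x y → depth x ≡ suc (depth y)
    depth-child {x} {y} e =
      suc-injective (trans (sym (length-pathTo x)) (trans (cong length e) (cong suc (length-pathTo y))))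

    parent-exists : ∀ {z} → z ≢ r → ∃ λ y → Adj T z y × ChildOf z y
    parent-exists {z} z≢r = go z≢r (pathTo-path z) (pathTo-unique z)
      where
      go : ∀ {x vs} → x ≢ r → Path x r vs → Unique vs → ∃ λ y → Adj T x y × vs ≡ x ∷ pathTo y
      go x≢r nil _ = ⊥-elim (x≢r refl)
      go {x} _ (cons a p) (_ ∷ u) = _ , a , cong (x ∷_) (pathTo-canonical p u)

    pathTo-root : pathTo r ≡ r ∷ []
    pathTo-root = sym (pathTo-canonical nil ([] ∷ []))

    depth-root : depth r ≡ 0
    depth-root = n≤0⇒n≡0 (depth-≤-walk-to-root here)

    depth≡0⇒root : ∀ {z} → depth z ≡ 0 → z ≡ r
    depth≡0⇒root {z} = go (pathTo-path z)
      where
      go : ∀ {x vs} (p : Path x r vs) → steps p ≡ 0 → x ≡ r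
      go nil _ = refl
      go (cons _ _) ()

    ≢root⇒depth≢0 : ∀ {z} → z ≢ r → depth z ≢ 0
    ≢root⇒depth≢0 z≢r e = z≢r (depth≡0⇒root e)

    depth≡suc⇒≢root : ∀ {z k} → depth z ≡ suc k → z ≢ r
    depth≡suc⇒≢root e refl = 0≢1+n (trans (sym depth-root) e)

    root-neighbour-child : ∀ {w} → Adj T w r → ChildOf w r
    root-neighbour-child {w} a with adjacent-child a
    ... | inj₁ e = ⊥-elim (vertices-nonempty (pathTo-path w) (sym (∷-injectiveʳ (trans (sym pathTo-root) e))))
    ... | inj₂ e = e

    root-neighbour-depth : ∀ {w} → Adj T w r → depth w ≡ 1
    root-neighbour-depth a = trans (depth-child (root-neighbour-child a)) (cong suc depth-root)

    depth-adjacent : ∀ {x y} → Adj T x y → depth x ≤ suc (depth y)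
    depth-adjacent {x} a with adjacent-child a
    ... | inj₁ e = subst (λ d → depth x ≤ suc d) (sym (depth-child e)) (≤-trans (n≤1+n _) (n≤1+n _))
    ... | inj₂ e = ≤-reflexive (depth-child e)

    private
      lastButOne : List (Fin m) → Fin m
      lastButOne [] = r
      lastButOne (a ∷ []) = a
      lastButOne (a ∷ _ ∷ []) = a
      lastButOne (_ ∷ b ∷ c ∷ l) = lastButOne (b ∷ c ∷ l)

      lastButOne-drop : ∀ {a b l} → l ≢ [] → lastButOne (a ∷ b ∷ l) ≡ lastButOne (b ∷ l)
      lastButOne-drop {l = []} l≢[] = ⊥-elim (l≢[] refl)
      lastButOne-drop {l = _ ∷ _} _ = refl

    -- The root of the component of T - r containing z (r itself for z = r).
    branch : Fin m → Fin m
    branch z = lastButOne (pathTo z)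

    branch-child : ∀ {x y} → ChildOf x y → y ≢ r → branch x ≡ branch y
    branch-child {x} {y} e y≢r with parent-exists y≢r
    ... | y′ , _ , e′ = begin
      branch x                        ≡⟨ cong lastButOne (trans e (cong (x ∷_) e′)) ⟩
      lastButOne (x ∷ y ∷ pathTo y′)  ≡⟨ lastButOne-drop (vertices-nonempty (pathTo-path y′)) ⟩
      lastButOne (y ∷ pathTo y′)      ≡⟨ cong lastButOne e′ ⟨
      branch y                        ∎
      where open ≡-Reasoning

    branch-root-child : ∀ {x} → ChildOf x r → branch x ≡ x
    branch-root-child {x} e = cong lastButOne (trans e (cong (x ∷_) pathTo-root))

    branch-adjacent : ∀ {x y} → Adj T x y → x ≢ r → y ≢ r → branch x ≡ branch y
    branch-adjacent a x≢r y≢r with adjacent-child a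
    ... | inj₁ e = sym (branch-child e x≢r)
    ... | inj₂ e = branch-child e y≢r

    Adj⁻ : Fin m → Fin m → Set
    Adj⁻ = AdjWithout T r

    private
      branch-spec : ∀ d z → depth z ≡ d → z ≢ r →
                    Adj T (branch z) r × Walk Adj⁻ (branch z) z (pred (depth z))
      branch-spec zero z e z≢r = ⊥-elim (z≢r (depth≡0⇒root e))
      branch-spec (suc d) z e z≢r with parent-exists z≢r
      ... | y , a , child with y ≟F r
      ...   | yes refl rewrite branch-root-child child | depth-child child | depth-root = a , here
      ...   | no y≢r with branch-spec d y (suc-injective (trans (sym (depth-child child)) e)) y≢r
      ...     | a′ , w rewrite branch-child child y≢r =
                a′ , subst (Walk Adj⁻ (branch y) z) depth-y≡pred-depth-z (walk-snoc w (adj-sym T a , y≢r , z≢r))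
        where
        depth-y≡pred-depth-z : suc (pred (depth y)) ≡ pred (depth z)
        depth-y≡pred-depth-z =
          trans (suc-pred (depth y) {{≢-nonZero (≢root⇒depth≢0 y≢r)}}) (cong pred (sym (depth-child child)))

    branch-adj-root : ∀ {z} → z ≢ r → Adj T (branch z) r
    branch-adj-root z≢r = proj₁ (branch-spec _ _ refl z≢r)

    branch-walk : ∀ {z w} → z ≢ r → branch z ≡ w → Walk Adj⁻ w z (pred (depth z))
    branch-walk z≢r refl = proj₂ (branch-spec _ _ refl z≢r)

    cross-branch-walk : ∀ {z y k} → Walk (Adj T) z y k → z ≢ r → y ≢ r → branch z ≢ branch y →
                        depth z + depth y ≤ k
    cross-branch-walk here _ _ b≢ = ⊥-elim (b≢ refl)
    cross-branch-walk (there {z = z′} a w) z≢r y≢r b≢ with z′ ≟F r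
    ... | yes refl rewrite root-neighbour-depth a = s≤s (depth-≤-walk-from-root w)
    ... | no z′≢r = ≤-trans (+-monoˡ-≤ _ (depth-adjacent a))
                            (s≤s (cross-branch-walk w z′≢r y≢r (λ e → b≢ (trans (branch-adjacent a z≢r z′≢r) e))))

    avoiding-walk-≢root : ∀ {a b k} → Walk Adj⁻ a b k → a ≢ r → b ≢ r
    avoiding-walk-≢root here a≢r = a≢r
    avoiding-walk-≢root (there (_ , _ , c≢r) w) _ = avoiding-walk-≢root w c≢r

    avoiding-walk-branch : ∀ {a b k} → Walk Adj⁻ a b k → a ≢ r → branch a ≡ branch b
    avoiding-walk-branch here _ = refl
    avoiding-walk-branch (there (e , a≢r , c≢r) w) _ =
      trans (branch-adjacent e a≢r c≢r) (avoiding-walk-branch w c≢r)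

    reachable-from-neighbour : ∀ {w x k} → Adj T r w → Walk Adj⁻ w x k →
                               branch x ≡ w × x ≢ r × depth x ≤ suc k
    reachable-from-neighbour a p =
      trans (sym (avoiding-walk-branch p w≢r)) (branch-root-child (root-neighbour-child (adj-sym T a))) ,
      avoiding-walk-≢root p w≢r ,
      depth-≤-walk-from-root (there a (walk-map proj₁ p))
      where
      w≢r : _ ≢ r
      w≢r e = adj-≢ a (sym e)

    eccentricity-≤ : ∀ B → (∀ z → depth z ≤ B) → ∃ λ e → Ecc T r e × e ≤ B
    eccentricity-≤ B depth≤B = depth deepest , (bound , deepest , dist-depth deepest) , depth≤B deepest
      where
      deepest = argmax depth r (allFin m)
      bound : ∀ y k → Dist T r y k → k ≤ depth deepest
      bound y k d = subst (_≤ depth deepest) (sym (dist-root-unique d))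
                          (All-lookup (f[xs]≤f[argmax] r (allFin m)) (∈-allFin y))

    depth-one⇒adj-root : ∀ {y} → depth y ≡ 1 → Adj T y r
    depth-one⇒adj-root d with parent-exists (depth≡suc⇒≢root d)
    ... | p , a , child = subst (Adj T _) (depth≡0⇒root (suc-injective (trans (sym (depth-child child)) d))) a

    depth-one⇒branch-self : ∀ {y} → depth y ≡ 1 → branch y ≡ y
    depth-one⇒branch-self d = branch-root-child (root-neighbour-child (depth-one⇒adj-root d))

    depth-two⇒adj-branch : ∀ {y} → depth y ≡ 2 → Adj T y (branch y)
    depth-two⇒adj-branch d with parent-exists (depth≡suc⇒≢root d)
    ... | p , a , child = subst (Adj T _) (sym (trans (branch-child child (depth≡suc⇒≢root depth-p))
                                                     (depth-one⇒branch-self depth-p))) a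
      where
      depth-p = suc-injective (trans (sym (depth-child child)) d)

    near-branch : ∀ {t x y w} → t ≢ r → Near T t x y → x ≢ r → y ≢ r →
                  branch x ≡ w → branch y ≡ w → branch t ≡ w
    near-branch _ (inj₁ refl) _ _ bx _ = bx
    near-branch _ (inj₂ (inj₁ refl)) _ _ _ by = by
    near-branch t≢r (inj₂ (inj₂ (inj₁ a))) x≢r _ bx _ = trans (branch-adjacent a t≢r x≢r) bx
    near-branch t≢r (inj₂ (inj₂ (inj₂ a))) _ y≢r _ by = trans (branch-adjacent a t≢r y≢r) by

    edge-cover-by-children : ∀ S → (∀ x y → Adj T x y → ChildOf x y → ∃ λ s → s ∈ S × Near T s x y) →
                             EdgeCover T S
    edge-cover-by-children S cover x y a with adjacent-child a
    ... | inj₂ e = cover x y a e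
    ... | inj₁ e with cover y x (adj-sym T a) e
    ...   | s , s∈ , near = s , s∈ , Near-swap {T = T} near

-- Trees of radius three, rooted at a vertex of eccentricity three

module Eccentricity3 {m} (T : Graph m) (tree : IsTree T) (r : Fin m) (ecc : Ecc T r 3) where

  open Tree T tree public
  open Rooted r public

  depth≤3 : ∀ z → depth z ≤ 3
  depth≤3 z = proj₁ ecc z (depth z) (dist-depth z)

  deep-edge-not-near-root : ∀ {x y} → depth x ≡ 3 → ChildOf x y → ¬ Near T r x y
  deep-edge-not-near-root {x} {y} d3 child = not-near
    where
    depth-y : depth y ≡ 2
    depth-y = suc-injective (trans (sym (depth-child child)) d3)
    not-near : ¬ Near T r x y
    not-near (inj₁ r≡x) = depth≡suc⇒≢root d3 (sym r≡x)
    not-near (inj₂ (inj₁ r≡y)) = depth≡suc⇒≢root depth-y (sym r≡y)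
    not-near (inj₂ (inj₂ (inj₁ a))) with trans (sym d3) (root-neighbour-depth (adj-sym T a))
    ... | ()
    not-near (inj₂ (inj₂ (inj₂ a))) with trans (sym depth-y) (root-neighbour-depth (adj-sym T a))
    ... | ()

  edge-cover-by-levels : ∀ S →
    (∀ x → Adj T x r → ∃ λ s → s ∈ S × Near T s x r) →
    (∀ x y → Adj T x y → ChildOf x y → depth y ≡ 1 → ∃ λ s → s ∈ S × Near T s x y) →
    (∀ x y → ChildOf x y → depth x ≡ 3 → branch y ∈ S) →
    EdgeCover T S
  edge-cover-by-levels S to-root to-depth-one deep = edge-cover-by-children S cover
    where
    cover : ∀ x y → Adj T x y → ChildOf x y → ∃ λ s → s ∈ S × Near T s x y
    cover x y a child with depth y in eq
    ... | zero with depth≡0⇒root eq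
    ...   | refl = to-root x a
    cover x y a child | suc zero = to-depth-one x y a child eq
    cover x y a child | suc (suc zero) =
      branch y , deep x y child (trans (depth-child child) (cong suc eq)) ,
      inj₂ (inj₂ (inj₂ (adj-sym T (depth-two⇒adj-branch eq))))
    cover x y a child | suc (suc (suc k)) with depth≤3 x
    ... | depth-x≤3 rewrite depth-child child | eq with depth-x≤3
    ...   | s≤s (s≤s (s≤s ()))

  deep-edge-mapped : ∀ (g : Fin m → Fin m) {x w} → depth x ≡ 3 → branch x ≡ w →
                     (∀ t → t ≢ r → branch t ≡ w → g t ≡ w) → EdgeMappedTo T g w
  deep-edge-mapped g {x} {w} d3 bx g-on-branch with parent-exists (depth≡suc⇒≢root d3)
  ... | y , a , child = x , y , a , to-branch
    where
    depth-y : depth y ≡ 2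
    depth-y = suc-injective (trans (sym (depth-child child)) d3)
    to-branch : ∀ t → Near T t x y → g t ≡ w
    to-branch t near with t ≟F r
    ... | yes refl = ⊥-elim (deep-edge-not-near-root d3 child near)
    ... | no t≢r = g-on-branch t t≢r
      (near-branch t≢r near (depth≡suc⇒≢root d3) (depth≡suc⇒≢root depth-y) bx
                   (trans (sym (branch-child child (depth≡suc⇒≢root depth-y))) bx))

  height≤2 : ∀ {w} → Adj T r w → ∀ x k → DistR Adj⁻ w x k → k ≤ 2
  height≤2 a x k d with reachable-from-neighbour a (proj₁ d)
  ... | bx , x≢r , _ = ≤-trans (DistR-≤-walk d (branch-walk x≢r bx)) (pred-mono-≤ (depth≤3 x))

  deep⇒height-two : ∀ {w x} → Adj T r w → branch x ≡ w → depth x ≡ 3 → Height T r w 2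
  deep⇒height-two a bx d3 =
    height≤2 a , _ , subst (Walk Adj⁻ _ _) (cong pred d3) (branch-walk x≢r bx) , shortest
    where
    x≢r = depth≡suc⇒≢root d3
    shortest : ∀ j → j < 2 → ¬ Walk Adj⁻ _ _ j
    shortest j j<2 w = <⇒≱ (s≤s j<2) (subst (_≤ suc j) d3 (proj₂ (proj₂ (reachable-from-neighbour a w))))

  height-two⇒deep : ∀ {w} → Adj T r w → Height T r w 2 → ∃ λ x → branch x ≡ w × depth x ≡ 3
  height-two⇒deep a (_ , x , d) with reachable-from-neighbour a (proj₁ d)
  ... | bx , x≢r , depth-x≤3 = x , bx , ≤-antisym depth-x≤3 3≤depth-x
    where
    3≤depth-x : 3 ≤ depth x
    3≤depth-x = subst (3 ≤_) (suc-pred (depth x) {{≢-nonZero (≢root⇒depth≢0 x≢r)}})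
                      (s≤s (DistR-≤-walk d (branch-walk x≢r bx)))

-- Trees with a unique centre

module UniqueCentre {m} (T : Graph m) (tree : IsTree T) (u : Fin m) (ecc : Ecc T u 3)
                    (S : Subset m) (S-spec : ∀ w → (w ∈ S) ⇔ (Adj T u w × Height T u w 2)) where

  open Eccentricity3 T tree u ecc

  ∈S⇒height-two : ∀ {w} → w ∈ S → Adj T u w × Height T u w 2
  ∈S⇒height-two {w} = Equivalence.to (S-spec w)

  height-two⇒∈S : ∀ {w} → Adj T u w × Height T u w 2 → w ∈ S
  height-two⇒∈S {w} = Equivalence.from (S-spec w)

  u∉S : u ∉ S
  u∉S u∈ = adj-irrefl T (proj₁ (∈S⇒height-two u∈))

  S-nonempty : ∃ λ w → w ∈ S
  S-nonempty with proj₂ ecc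
  ... | x , d = branch x , height-two⇒∈S (w-adj , deep⇒height-two w-adj refl d3)
    where
    d3 = sym (dist-root-unique d)
    w-adj = adj-sym T (branch-adj-root (depth≡suc⇒≢root d3))

  deep-branch∈S : ∀ x y → ChildOf x y → depth x ≡ 3 → branch y ∈ S
  deep-branch∈S x y child d3 = height-two⇒∈S (w-adj , deep⇒height-two w-adj (branch-child child y≢u) d3)
    where
    y≢u = depth≡suc⇒≢root (suc-injective (trans (sym (depth-child child)) d3))
    w-adj = adj-sym T (branch-adj-root y≢u)

  branchOr : Fin m → Fin m → Fin m
  branchOr c t with t ≟F u
  ... | yes _ = c
  ... | no _ = branch t

  height-two-mapped : ∀ c w → w ∈ S → EdgeMappedTo T (branchOr c) w
  height-two-mapped c w w∈ with height-two⇒deep (proj₁ (∈S⇒height-two w∈)) (proj₂ (∈S⇒height-two w∈))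
  ... | x , bx , d3 = deep-edge-mapped (branchOr c) d3 bx on-branch
    where
    on-branch : ∀ t → t ≢ u → branch t ≡ w → branchOr c t ≡ w
    on-branch t t≢u bt with t ≟F u
    ... | yes t≡u = ⊥-elim (t≢u t≡u)
    ... | no _ = bt

  height-one-mapped : ∀ {w} → Adj T u w → Height T u w 1 → EdgeMappedTo T (branchOr w) w
  height-one-mapped {w} a (_ , z , d) with proj₁ d
  ... | there (wz , w≢u , z≢u) here = w , z , wz , to-w
    where
    bw : branch w ≡ w
    bw = branch-root-child (root-neighbour-child (adj-sym T a))
    bz : branch z ≡ w
    bz = proj₁ (reachable-from-neighbour a (proj₁ d))
    to-w : ∀ t → Near T t w z → branchOr w t ≡ w
    to-w t near with t ≟F u
    ... | yes _ = refl
    ... | no t≢u = near-branch t≢u near w≢u z≢u bw bz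

  no-height-one : ¬ (∃[ w ] (Adj T u w × Height T u w 1)) → EdgeCoverNumber T ∣ S ∣
  no-height-one ∄w = (S , edge-cover-by-levels S to-root to-depth-one deep-branch∈S , refl , S-nonempty) ,
                     weak-cover-≥ {T = T} (branchOr u) S (height-two-mapped u)
    where
    to-root : ∀ x → Adj T x u → ∃ λ s → s ∈ S × Near T s x u
    to-root x _ with S-nonempty
    ... | w , w∈ = w , w∈ , inj₂ (inj₂ (inj₂ (adj-sym T (proj₁ (∈S⇒height-two w∈)))))
    to-depth-one : ∀ x y → Adj T x y → ChildOf x y → depth y ≡ 1 → ∃ λ s → s ∈ S × Near T s x y
    to-depth-one x y a child d1 with y ∈? S
    ... | yes y∈ = y , y∈ , inj₂ (inj₁ refl)
    ... | no y∉ = ⊥-elim (∄w (y , uy , bound , x , yx , shortest))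
      where
      uy = adj-sym T (depth-one⇒adj-root d1)
      y≢u = depth≡suc⇒≢root d1
      x≢u = depth≡suc⇒≢root (trans (depth-child child) (cong suc d1))
      bound : ∀ z k → DistR Adj⁻ y z k → k ≤ 1
      bound z k d = ≤-pred (≤∧≢⇒< (height≤2 uy z k d)
                      (λ { refl → y∉ (height-two⇒∈S (uy , height≤2 uy , z , d)) }))
      yx : Walk Adj⁻ y x 1
      yx = there (adj-sym T a , y≢u , x≢u) here
      shortest : ∀ j → j < 1 → ¬ Walk Adj⁻ y x j
      shortest zero _ w = adj-≢ a (sym (walk-zero w))
      shortest (suc j) (s≤s ()) _

  with-height-one : ∃[ w ] (Adj T u w × Height T u w 1) → EdgeCoverNumber T (suc ∣ S ∣)
  with-height-one (w₁ , a₁ , h₁) =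
    (⁅ u ⁆ ∪ S , edge-cover-by-levels _ to-root to-depth-one deep ,
     x∉p⇒∣⁅x⁆∪p∣≡1+∣p∣ u S u∉S , u , u∈) ,
    λ S′ cover → subst (_≤ ∣ S′ ∣) ∣P∣
                   (weak-cover-≥ {T = T} (branchOr w₁) (⁅ w₁ ⁆ ∪ S) mapped S′ cover)
    where
    u∈ : u ∈ ⁅ u ⁆ ∪ S
    u∈ = x∈p∪q⁺ (inj₁ (x∈⁅x⁆ u))
    to-root : ∀ x → Adj T x u → ∃ λ s → s ∈ ⁅ u ⁆ ∪ S × Near T s x u
    to-root _ _ = u , u∈ , inj₂ (inj₁ refl)
    to-depth-one : ∀ x y → Adj T x y → ChildOf x y → depth y ≡ 1 → ∃ λ s → s ∈ ⁅ u ⁆ ∪ S × Near T s x y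
    to-depth-one _ _ _ _ d1 = u , u∈ , inj₂ (inj₂ (inj₂ (adj-sym T (depth-one⇒adj-root d1))))
    deep : ∀ x y → ChildOf x y → depth x ≡ 3 → branch y ∈ ⁅ u ⁆ ∪ S
    deep x y child d3 = x∈p∪q⁺ (inj₂ (deep-branch∈S x y child d3))
    ∣P∣ : ∣ ⁅ w₁ ⁆ ∪ S ∣ ≡ suc ∣ S ∣
    ∣P∣ = x∉p⇒∣⁅x⁆∪p∣≡1+∣p∣ w₁ S
            (λ w₁∈ → 1≢2 (Height-unique {G = T} h₁ (proj₂ (∈S⇒height-two w₁∈))))
      where
      1≢2 : 1 ≢ 2
      1≢2 ()
    mapped : ∀ w → w ∈ ⁅ w₁ ⁆ ∪ S → EdgeMappedTo T (branchOr w₁) w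
    mapped w w∈ with ∈⁅x⁆∪p⁻ w₁ S w∈
    ... | inj₁ refl = height-one-mapped a₁ h₁
    ... | inj₂ w∈S = height-two-mapped w₁ w w∈S

-- Trees with two centres

module TwoCentres {m} (T : Graph m) (tree : IsTree T) (rad : Radius T 3) where

  open Tree T tree using (module Rooted)

  no-vertex-within-two : ∀ w → ¬ (∀ z → Rooted.depth w z ≤ 2)
  no-vertex-within-two w close with Rooted.eccentricity-≤ w 2 close
  ... | e , ecc-w , e≤2 = <⇒≱ (s≤s e≤2) (proj₂ rad _ e ecc-w)

  module Towards (a b : Fin m) (a≢b : a ≢ b) (ea : Ecc T a 3) (eb : Ecc T b 3) where

    module A = Eccentricity3 T tree a ea
    module B = Eccentricity3 T tree b eb

    b≢a : b ≢ a
    b≢a e = a≢b (sym e)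

    -- If the deepest vertex x hung below another neighbour w of a, then either
    -- b would be too far from x, or w would have eccentricity two.
    deep⇒branch≡b : ∀ x → A.depth x ≡ 3 → A.branch x ≡ b
    deep⇒branch≡b x d3 with A.branch b ≟F A.branch x
    ... | no b≢ = ⊥-elim (b≢a (A.depth≡0⇒root (n≤0⇒n≡0 (+-cancelʳ-≤ 3 (A.depth b) 0 b-too-far))))
      where
      b-too-far : A.depth b + 3 ≤ 3
      b-too-far = subst (λ d → A.depth b + d ≤ 3) d3
                    (≤-trans (A.cross-branch-walk (proj₁ (B.dist-depth x)) b≢a (A.depth≡suc⇒≢root d3) b≢)
                             (B.depth≤3 x))
    ... | yes bb≡bx with b ≟F A.branch x
    ...   | yes b≡w = sym b≡w
    ...   | no b≢w = ⊥-elim (no-vertex-within-two (A.branch x) w-close)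
      where
      module W = A.Rooted (A.branch x)
      x≢a = A.depth≡suc⇒≢root d3
      wa : Adj T (A.branch x) a
      wa = A.branch-adj-root x≢a
      2≤depth-b : 2 ≤ A.depth b
      2≤depth-b with A.depth b in eq
      ... | zero = ⊥-elim (A.≢root⇒depth≢0 b≢a eq)
      ... | suc zero = ⊥-elim (b≢w (trans (sym (A.depth-one⇒branch-self eq)) bb≡bx))
      ... | suc (suc _) = s≤s (s≤s z≤n)
      w-close : ∀ z → W.depth z ≤ 2
      w-close z with z ≟F a
      ... | yes refl = ≤-trans (W.depth-≤-walk-to-root (there (adj-sym T wa) here)) (s≤s z≤n)
      ... | no z≢a with A.branch z ≟F A.branch x
      ...   | yes bz = ≤-trans (W.depth-≤-walk-from-root (walk-map proj₁ (A.branch-walk z≢a bz)))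
                               (pred-mono-≤ (A.depth≤3 z))
      ...   | no bz≢ = W.depth-≤-walk-from-root (there wa (there (adj-sym T za) here))
        where
        depth-z≤1 : A.depth z ≤ 1
        depth-z≤1 = +-cancelˡ-≤ 2 (A.depth z) 1
          (≤-trans (+-monoˡ-≤ (A.depth z) 2≤depth-b)
            (≤-trans (A.cross-branch-walk (proj₁ (B.dist-depth z)) b≢a z≢a (λ e → bz≢ (trans (sym e) bb≡bx)))
                     (B.depth≤3 z)))
        za : Adj T z a
        za = A.depth-one⇒adj-root (≤-antisym depth-z≤1 (n≢0⇒n>0 (A.≢root⇒depth≢0 z≢a)))

    branches-disjoint : ∀ t → t ≢ a → A.branch t ≡ b → t ≢ b → B.branch t ≡ a → ⊥
    branches-disjoint t t≢a at t≢b bt = <-asym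
      (m≤pred[n]⇒suc[m]≤n {{≢-nonZero (B.≢root⇒depth≢0 t≢b)}}
        (A.depth-≤-walk-from-root (walk-map proj₁ (B.branch-walk t≢b bt))))
      (m≤pred[n]⇒suc[m]≤n {{≢-nonZero (A.≢root⇒depth≢0 t≢a)}}
        (B.depth-≤-walk-from-root (walk-map proj₁ (A.branch-walk t≢a at))))

    a∈pair : a ∈ ⁅ a ⁆ ∪ ⁅ b ⁆
    a∈pair = x∈p∪q⁺ (inj₁ (x∈⁅x⁆ a))

    pair-cover : EdgeCover T (⁅ a ⁆ ∪ ⁅ b ⁆)
    pair-cover = A.edge-cover-by-levels _ to-root to-depth-one deep
      where
      to-root : ∀ x → Adj T x a → ∃ λ s → s ∈ ⁅ a ⁆ ∪ ⁅ b ⁆ × Near T s x a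
      to-root _ _ = a , a∈pair , inj₂ (inj₁ refl)
      to-depth-one : ∀ x y → Adj T x y → A.ChildOf x y → A.depth y ≡ 1 →
                     ∃ λ s → s ∈ ⁅ a ⁆ ∪ ⁅ b ⁆ × Near T s x y
      to-depth-one _ _ _ _ d1 = a , a∈pair , inj₂ (inj₂ (inj₂ (adj-sym T (A.depth-one⇒adj-root d1))))
      deep : ∀ x y → A.ChildOf x y → A.depth x ≡ 3 → A.branch y ∈ ⁅ a ⁆ ∪ ⁅ b ⁆
      deep x y child d3 =
        subst (_∈ ⁅ a ⁆ ∪ ⁅ b ⁆) (trans (sym (deep⇒branch≡b x d3)) (A.branch-child child y≢a))
              (x∈p∪q⁺ (inj₂ (x∈⁅x⁆ b)))
        where
        y≢a = A.depth≡suc⇒≢root (suc-injective (trans (sym (A.depth-child child)) d3))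

    -- Sends the deepest edges seen from a to b, and those seen from b to a.
    towards : Fin m → Fin m
    towards t with t ≟F a | A.branch t ≟F b
    ... | no _ | yes _ = b
    ... | _    | _     = a

    b-mapped : EdgeMappedTo T towards b
    b-mapped with proj₂ ea
    ... | x , d = A.deep-edge-mapped towards d3 (deep⇒branch≡b x d3) on-branch
      where
      d3 = sym (A.dist-root-unique d)
      on-branch : ∀ t → t ≢ a → A.branch t ≡ b → towards t ≡ b
      on-branch t t≢a bt with t ≟F a | A.branch t ≟F b
      ... | yes t≡a | _ = ⊥-elim (t≢a t≡a)
      ... | no _ | yes _ = refl
      ... | no _ | no bt≢ = ⊥-elim (bt≢ bt)

    a-mapped : (∀ x → B.depth x ≡ 3 → B.branch x ≡ a) → EdgeMappedTo T towards a
    a-mapped deep⇒branch≡a with proj₂ eb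
    ... | x , d = B.deep-edge-mapped towards d3 (deep⇒branch≡a x d3) on-branch
      where
      d3 = sym (B.dist-root-unique d)
      on-branch : ∀ t → t ≢ b → B.branch t ≡ a → towards t ≡ a
      on-branch t t≢b bt with t ≟F a | A.branch t ≟F b
      ... | yes _ | _ = refl
      ... | no t≢a | yes at = ⊥-elim (branches-disjoint t t≢a at t≢b bt)
      ... | no _ | no _ = refl

  two-centres : CenterHasTwo T → EdgeCoverNumber T 2
  two-centres (a , b , a≢b , ca , cb , _) =
    (⁅ a ⁆ ∪ ⁅ b ⁆ , pair-cover , x≢y⇒∣⁅x⁆∪⁅y⁆∣≡2 a≢b , a , a∈pair) ,
    λ S cover → subst (_≤ ∣ S ∣) (x≢y⇒∣⁅x⁆∪⁅y⁆∣≡2 a≢b)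
                  (weak-cover-≥ {T = T} towards _ mapped S cover)
    where
    ea = central⇒Ecc {G = T} rad ca
    eb = central⇒Ecc {G = T} rad cb
    open Towards a b a≢b ea eb
    mapped : ∀ w → w ∈ ⁅ a ⁆ ∪ ⁅ b ⁆ → EdgeMappedTo T towards w
    mapped w w∈ with ∈⁅x⁆∪p⁻ a ⁅ b ⁆ w∈
    ... | inj₁ refl = a-mapped (Towards.deep⇒branch≡b b a b≢a eb ea)
    ... | inj₂ w∈⁅b⁆ rewrite x∈⁅y⁆⇒x≡y b w∈⁅b⁆ = b-mapped

-- Distances in the corona product

module CoronaDistances {n m} (G : Graph n) (T : Graph m) where

  Vertex : Set
  Vertex = Fin n ⊎ (Fin n × Fin m)

  _~_ : Vertex → Vertex → Set
  _~_ = CoronaAdj' G T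

  encode : Vertex → Fin (n + n * m)
  encode (inj₁ i) = i ↑ˡ (n * m)
  encode (inj₂ (i , t)) = n ↑ʳ combine i t

  coronaView-encode : ∀ v → coronaView {n} {m} (encode v) ≡ v
  coronaView-encode (inj₁ i) rewrite splitAt-↑ˡ n i (n * m) = refl
  coronaView-encode (inj₂ (i , t)) rewrite splitAt-↑ʳ n (n * m) (combine i t) | remQuot-combine {n} {m} i t = refl

  encode-coronaView : ∀ x → encode (coronaView {n} {m} x) ≡ x
  encode-coronaView x with splitAt n x in eq
  ... | inj₁ i = trans (cong (join n (n * m)) (sym eq)) (join-splitAt n (n * m) x)
  ... | inj₂ j = trans (cong (n ↑ʳ_) (combine-remQuot {n} m j))
                       (trans (cong (join n (n * m)) (sym eq)) (join-splitAt n (n * m) x))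

  data CWalk : Vertex → Vertex → ℕ → Set where
    stay : ∀ {a} → CWalk a a 0
    step : ∀ {a c b k} → a ~ c → CWalk c b k → CWalk a b (suc k)

  cwalk-snoc : ∀ {a b c k} → CWalk a b k → b ~ c → CWalk a c (suc k)
  cwalk-snoc stay r = step r stay
  cwalk-snoc (step r′ w) r = step r′ (cwalk-snoc w r)

  walk⇒cwalk : ∀ {x y k} → Walk (Adj (corona G T)) x y k → CWalk (coronaView x) (coronaView y) k
  walk⇒cwalk here = stay
  walk⇒cwalk (there r w) = step r (walk⇒cwalk w)

  cwalk⇒walk : ∀ {a b k} → CWalk a b k → Walk (Adj (corona G T)) (encode a) (encode b) k
  cwalk⇒walk stay = here
  cwalk⇒walk (step {a} {c} r w) =
    there (subst₂ _~_ (sym (coronaView-encode a)) (sym (coronaView-encode c)) r) (cwalk⇒walk w)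

  CDist : Vertex → Vertex → ℕ → Set
  CDist a b k = CWalk a b k × (∀ j → j < k → ¬ CWalk a b j)

  CDist⇒Dist : ∀ {a b k} → CDist a b k → Dist (corona G T) (encode a) (encode b) k
  CDist⇒Dist {a} {b} (w , shortest) =
    cwalk⇒walk w ,
    λ j j< w′ → shortest j j<
      (subst₂ (λ p q → CWalk p q j) (coronaView-encode a) (coronaView-encode b) (walk⇒cwalk w′))

  Dist⇒CDist : ∀ {a b k} → Dist (corona G T) (encode a) (encode b) k → CDist a b k
  Dist⇒CDist {a} {b} (w , shortest) =
    subst₂ (λ p q → CWalk p q _) (coronaView-encode a) (coronaView-encode b) (walk⇒cwalk w) ,
    λ j j< w′ → shortest j j< (cwalk⇒walk w′)

  CDist-≤-walk : ∀ {a b k l} → CDist a b k → CWalk a b l → k ≤ l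
  CDist-≤-walk (_ , shortest) w = ≮⇒≥ (λ l<k → shortest _ l<k w)

  cdist-zero : ∀ {a} → CDist a a 0
  cdist-zero = stay , λ _ ()

  cdist-one : ∀ {a b} → a ≢ b → a ~ b → CDist a b 1
  cdist-one a≢b r = step r stay , λ { zero _ stay → a≢b refl ; (suc j) (s≤s ()) _ }

  cdist-two : ∀ {a b c} → a ~ b → b ~ c → a ≢ c → ¬ a ~ c → CDist a c 2
  cdist-two r₁ r₂ a≢c a≁c = step r₁ (step r₂ stay) ,
    λ { zero _ stay → a≢c refl ; (suc zero) _ (step r stay) → a≁c r ; (suc (suc j)) (s≤s (s≤s ())) _ }

  OutsideCopy : Fin n → Vertex → Set
  OutsideCopy i z = ∀ t → z ≢ inj₂ (i , t)

  copyIndex : Vertex → Fin n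
  copyIndex (inj₁ i) = i
  copyIndex (inj₂ (i , _)) = i

  enters-through-hub : ∀ {i a z k} → CWalk z (inj₂ (i , a)) k → OutsideCopy i z →
                       ∃ λ j → j < k × CWalk z (inj₁ i) j
  enters-through-hub stay out = ⊥-elim (out _ refl)
  enters-through-hub (step {c = inj₁ _} r w) _ with enters-through-hub w (λ _ ())
  ... | j , j< , w′ = suc j , s≤s j< , step r w′
  enters-through-hub {i} (step {c = inj₂ (i′ , _)} r w) out with i′ ≟F i
  enters-through-hub {z = inj₁ _} (step r w) out | yes refl rewrite r = 0 , s≤s z≤n , stay
  enters-through-hub {z = inj₂ (_ , t)} (step r w) out | yes refl =
    ⊥-elim (out t (cong (λ j → inj₂ (j , t)) (proj₁ r)))
  ... | no i′≢i with enters-through-hub w (λ t e → i′≢i (cong copyIndex e))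
  ...   | j , j< , w′ = suc j , s≤s j< , step r w′

  outside-copy-equidistant : ∀ {i a b z k₁ k₂} → OutsideCopy i z →
                             CDist z (inj₂ (i , a)) k₁ → CDist z (inj₂ (i , b)) k₂ → k₁ ≡ k₂
  outside-copy-equidistant {i} {z = z} out d₁ d₂ = ≤-antisym (≤-via-hub d₁ d₂) (≤-via-hub d₂ d₁)
    where
    ≤-via-hub : ∀ {a b k₁ k₂} → CDist z (inj₂ (i , a)) k₁ → CDist z (inj₂ (i , b)) k₂ → k₁ ≤ k₂
    ≤-via-hub d d′ with enters-through-hub (proj₁ d′) out
    ... | j , j< , w = ≤-trans (CDist-≤-walk d (cwalk-snoc w refl)) j<

  non-neighbour-distance-two : ∀ {i t a k} → t ≢ a → ¬ Adj T t a → CDist (inj₂ (i , t)) (inj₂ (i , a)) k → k ≡ 2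
  non-neighbour-distance-two t≢a t≁a d with proj₁ d
  ... | stay = ⊥-elim (t≢a refl)
  ... | step r stay = ⊥-elim (t≁a (proj₂ r))
  ... | step _ (step _ _) = ≤-antisym (CDist-≤-walk d (step {c = inj₁ _} refl (step refl stay))) (s≤s (s≤s z≤n))

  CDistinguishes : Vertex → Vertex → Vertex → Set
  CDistinguishes w a b = ∃₂ λ k₁ k₂ → CDist w a k₁ × CDist w b k₂ × k₁ ≢ k₂

  CDistinguishes-swap : ∀ {w a b} → CDistinguishes w a b → CDistinguishes w b a
  CDistinguishes-swap (k₁ , k₂ , d₁ , d₂ , k₁≢k₂) = k₂ , k₁ , d₂ , d₁ , λ e → k₁≢k₂ (sym e)

  hub-edge-distinguished : ∀ {i j} s → Adj G i j → CDistinguishes (inj₂ (i , s)) (inj₁ i) (inj₁ j)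
  hub-edge-distinguished s ij =
    1 , 2 , cdist-one (λ ()) refl ,
    cdist-two refl ij (λ ()) (λ j≡i → adj-irrefl G (subst (Adj G _) j≡i ij)) , λ ()

  spoke-distinguished : ∀ {i i′} s t → Adj G i i′ → CDistinguishes (inj₂ (i′ , s)) (inj₁ i) (inj₂ (i , t))
  spoke-distinguished {i} {i′} s t ii′ =
    2 , 3 , cdist-two refl (adj-sym G ii′) (λ ()) (λ i≡i′ → i≢i′ (sym i≡i′)) ,
    (step refl (step (adj-sym G ii′) (step refl stay)) , shortest) , λ ()
    where
    i≢i′ : i′ ≢ i
    i≢i′ refl = adj-irrefl G ii′
    shortest : ∀ j → j < 3 → ¬ CWalk (inj₂ (i′ , s)) (inj₂ (i , t)) j
    shortest zero _ stay = adj-irrefl G ii′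
    shortest (suc zero) _ (step (i′≡i , _) stay) = i≢i′ i′≡i
    shortest (suc (suc zero)) _ (step {c = inj₁ _} e₁ (step e₂ stay)) = i≢i′ (trans (sym e₁) e₂)
    shortest (suc (suc zero)) _ (step {c = inj₂ _} (e₁ , _) (step (e₂ , _) stay)) = i≢i′ (trans e₁ e₂)
    shortest (suc (suc (suc j))) (s≤s (s≤s (s≤s ()))) _

  module WithoutTriangles (triangle-free : TriangleFree T) where

    copy-≢ : ∀ {i a b} → Adj T a b → _≢_ {A = Vertex} (inj₂ (i , a)) (inj₂ (i , b))
    copy-≢ ab refl = adj-irrefl T ab

    endpoint-distinguishes : ∀ {i a b} → Adj T a b → CDistinguishes (inj₂ (i , a)) (inj₂ (i , a)) (inj₂ (i , b))
    endpoint-distinguishes ab = 0 , 1 , cdist-zero , cdist-one (copy-≢ ab) (refl , ab) , λ ()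

    neighbour-distinguishes : ∀ {i s a b} → Adj T a b → Adj T s a →
                              CDistinguishes (inj₂ (i , s)) (inj₂ (i , a)) (inj₂ (i , b))
    neighbour-distinguishes {i} {s} {a} {b} ab sa with s ≟F b
    ... | yes refl = CDistinguishes-swap (endpoint-distinguishes (adj-sym T ab))
    ... | no s≢b = 1 , 2 , cdist-one (copy-≢ sa) (refl , sa) ,
                   cdist-two {b = inj₂ (i , a)} (refl , sa) (refl , ab) (λ { refl → s≢b refl })
                             (λ { (_ , sb) → triangle-free sa ab (adj-sym T sb) }) , λ ()

    near-distinguishes : ∀ {i s a b} → Adj T a b → Near T s a b →
                         CDistinguishes (inj₂ (i , s)) (inj₂ (i , a)) (inj₂ (i , b))
    near-distinguishes ab (inj₁ refl) = endpoint-distinguishes ab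
    near-distinguishes ab (inj₂ (inj₁ refl)) = CDistinguishes-swap (endpoint-distinguishes (adj-sym T ab))
    near-distinguishes ab (inj₂ (inj₂ (inj₁ sa))) = neighbour-distinguishes ab sa
    near-distinguishes ab (inj₂ (inj₂ (inj₂ sb))) = CDistinguishes-swap (neighbour-distinguishes (adj-sym T ab) sb)

    distinguished-from-cover : (∀ i → ∃ (Adj G i)) → ∀ S → EdgeCover T S → ∀ {s₀} → s₀ ∈ S →
                               ∀ a b → a ~ b → ∃₂ λ j s → s ∈ S × CDistinguishes (inj₂ (j , s)) a b
    distinguished-from-cover _ _ _ {s₀} s₀∈ (inj₁ i) (inj₁ j) ij = i , s₀ , s₀∈ , hub-edge-distinguished s₀ ij
    distinguished-from-cover nbr _ _ {s₀} s₀∈ (inj₁ i) (inj₂ (_ , t)) refl with nbr i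
    ... | i′ , ii′ = i′ , s₀ , s₀∈ , spoke-distinguished s₀ t ii′
    distinguished-from-cover nbr _ _ {s₀} s₀∈ (inj₂ (_ , t)) (inj₁ i) refl with nbr i
    ... | i′ , ii′ = i′ , s₀ , s₀∈ , CDistinguishes-swap (spoke-distinguished s₀ t ii′)
    distinguished-from-cover _ _ cover _ (inj₂ (i , a)) (inj₂ (_ , b)) (refl , ab) with cover a b ab
    ... | s , s∈ , near = i , s , s∈ , near-distinguishes ab near

-- The local metric dimension of a corona product

module Corona {n m} (G : Graph n) (T : Graph m) where

  open CoronaDistances G T

  inEveryCopy : Subset m → Subset (n + n * m)
  inEveryCopy S = ∅ {n} ++ᵛ concat (replicate n S)

  ∣inEveryCopy∣ : ∀ S → ∣ inEveryCopy S ∣ ≡ n * ∣ S ∣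
  ∣inEveryCopy∣ S = begin
    ∣ ∅ {n} ++ᵛ concat (replicate n S) ∣        ≡⟨ ∣p++q∣ (∅ {n}) _ ⟩
    ∣ ∅ {n} ∣ + ∣ concat (replicate n S) ∣   ≡⟨ cong₂ _+_ (∣⊥∣≡0 n) (∣concat∣ (replicate n S)) ⟩
    totalSize (replicate n S)               ≡⟨ totalSize-replicate n S ⟩
    n * ∣ S ∣                               ∎
    where open ≡-Reasoning

  encode∈inEveryCopy : ∀ {S} j {s} → s ∈ S → encode (inj₂ (j , s)) ∈ inEveryCopy S
  encode∈inEveryCopy {S} j {s} s∈ = lookup⇒[]= _ (inEveryCopy S) (begin
    lookup (inEveryCopy S) (n ↑ʳ combine j s)
      ≡⟨ lookup-++ʳ (∅ {n}) (concat (replicate n S)) (combine j s) ⟩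
    lookup (concat (replicate n S)) (combine j s) ≡⟨ lookup-concat (replicate n S) j s ⟩
    lookup (lookup (replicate n S) j) s          ≡⟨ cong (λ p → lookup p s) (lookup-replicate j S) ⟩
    lookup S s                                   ≡⟨ []=⇒lookup s∈ ⟩
    inside                                       ∎)
    where open ≡-Reasoning

  inEveryCopy-generator : Connected G → 2 ≤ n → TriangleFree T →
                          ∀ S → EdgeCover T S → ∀ {s₀} → s₀ ∈ S →
                          IsLocalMetricGenerator (corona G T) (inEveryCopy S)
  inEveryCopy-generator connected 2≤n triangle-free S cover s₀∈ x y xy
    with WithoutTriangles.distinguished-from-cover triangle-free (has-neighbour G connected 2≤n) S cover s₀∈
           (coronaView x) (coronaView y) xy
  ... | j , s , s∈ , k₁ , k₂ , d₁ , d₂ , k₁≢k₂ =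
    encode (inj₂ (j , s)) , encode∈inEveryCopy j s∈ , k₁ , k₂ ,
    subst (λ v → Dist (corona G T) _ v k₁) (encode-coronaView x) (CDist⇒Dist d₁) ,
    subst (λ v → Dist (corona G T) _ v k₂) (encode-coronaView y) (CDist⇒Dist d₂) , k₁≢k₂

  copy-edge-distinguisher : ∀ {v i a b} → CDistinguishes v (inj₂ (i , a)) (inj₂ (i , b)) →
                            ∃ λ t → v ≡ inj₂ (i , t) × ¬ ¬ Near T t a b
  copy-edge-distinguisher {inj₁ _} (_ , _ , d₁ , d₂ , k₁≢k₂) =
    ⊥-elim (k₁≢k₂ (outside-copy-equidistant (λ _ ()) d₁ d₂))
  copy-edge-distinguisher {inj₂ (j , t)} {i} (_ , _ , d₁ , d₂ , k₁≢k₂) with j ≟F i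
  ... | no j≢i = ⊥-elim (k₁≢k₂ (outside-copy-equidistant (λ _ e → j≢i (cong copyIndex e)) d₁ d₂))
  ... | yes refl = t , refl , λ not-near → k₁≢k₂ (trans
        (non-neighbour-distance-two (λ e → not-near (inj₁ e)) (λ ta → not-near (inj₂ (inj₂ (inj₁ ta)))) d₁)
        (sym (non-neighbour-distance-two (λ e → not-near (inj₂ (inj₁ e)))
                                         (λ tb → not-near (inj₂ (inj₂ (inj₂ tb)))) d₂)))

  copy-slice-weak-cover : ∀ (ys : Subset n) (ps : Vec (Subset m) n) →
                          IsLocalMetricGenerator (corona G T) (ys ++ᵛ concat ps) → ∀ i → WeakEdgeCover T (lookup ps i)
  copy-slice-weak-cover ys ps generator i a b ab ∄s
    with generator (encode (inj₂ (i , a))) (encode (inj₂ (i , b)))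
                   (subst₂ _~_ (sym (coronaView-encode (inj₂ (i , a))))
                               (sym (coronaView-encode (inj₂ (i , b)))) (refl , ab))
  ... | w , w∈ , k₁ , k₂ , d₁ , d₂ , k₁≢k₂
    with copy-edge-distinguisher (k₁ , k₂ , to-CDist d₁ , to-CDist d₂ , k₁≢k₂)
    where
    to-CDist : ∀ {v k} → Dist (corona G T) w (encode v) k → CDist (coronaView w) v k
    to-CDist d = Dist⇒CDist (subst (λ u → Dist (corona G T) u _ _) (sym (encode-coronaView w)) d)
  ... | t , w≡ , ¬¬near = ¬¬near (λ near → ∄s (t , t∈slice , near))
    where
    t∈slice : t ∈ lookup ps i
    t∈slice = lookup⇒[]= t (lookup ps i) (begin
      lookup (lookup ps i) t                   ≡⟨ lookup-concat ps i t ⟨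
      lookup (concat ps) (combine i t)          ≡⟨ lookup-++ʳ ys (concat ps) (combine i t) ⟨
      lookup (ys ++ᵛ concat ps) (encode (inj₂ (i , t)))
        ≡⟨ cong (lookup (ys ++ᵛ concat ps)) (trans (cong encode (sym w≡)) (encode-coronaView w)) ⟩
      lookup (ys ++ᵛ concat ps) w               ≡⟨ []=⇒lookup w∈ ⟩
      inside                                    ∎)
      where open ≡-Reasoning

  generator-≥ : ∀ {k} → (∀ S → WeakEdgeCover T S → k ≤ ∣ S ∣) →
                ∀ S → IsLocalMetricGenerator (corona G T) S → n * k ≤ ∣ S ∣
  generator-≥ {k} lower S generator with splitAtᵛ n S
  ... | ys , zs , refl with group n m zs
  ...   | ps , refl = begin
    n * k                        ≤⟨ totalSize-≥ k ps (λ i → lower _ (copy-slice-weak-cover ys ps generator i)) ⟩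
    totalSize ps                 ≤⟨ m≤n+m _ ∣ ys ∣ ⟩
    ∣ ys ∣ + totalSize ps         ≡⟨ cong (∣ ys ∣ +_) (∣concat∣ ps) ⟨
    ∣ ys ∣ + ∣ concat ps ∣        ≡⟨ ∣p++q∣ ys (concat ps) ⟨
    ∣ ys ++ᵛ concat ps ∣          ∎
    where open ≤-Reasoning

  local-metric-dim : Connected G → 2 ≤ n → TriangleFree T →
                     ∀ {k} → EdgeCoverNumber T k → LocalMetricDim (corona G T) (n * k)
  local-metric-dim connected 2≤n triangle-free ((S , cover , ∣S∣ , _ , s₀∈) , lower) =
    (inEveryCopy S , inEveryCopy-generator connected 2≤n triangle-free S cover s₀∈ ,
     trans (∣inEveryCopy∣ S) (cong (n *_) ∣S∣)) ,
    generator-≥ lower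

mainTheorem9 : ∀ {n m} (G : Graph n) (T : Graph m) →
    IsTree T → Radius T 3 → Connected G → 2 ≤ n →
    (CenterHasTwo T → LocalMetricDim (corona G T) (2 * n)) ×
    (∀ u → CenterIs T u → ∀ s → Varsigma T u s →
      ((∃[ w ] (Adj T u w × Height T u w 1)) → LocalMetricDim (corona G T) (n * (s + 1))) ×
      (¬ (∃[ w ] (Adj T u w × Height T u w 1)) → LocalMetricDim (corona G T) (n * s)))
mainTheorem9 {n} G T tree rad connected 2≤n =
  (λ two → subst (LocalMetricDim (corona G T)) (*-comm n 2) (dim (TwoCentres.two-centres T tree rad two))) ,
  λ { u (central-u , _) s (S , S-spec , refl) →
      let open UniqueCentre T tree u (central⇒Ecc {G = T} rad central-u) S S-spec in
      (λ h → subst (λ k → LocalMetricDim (corona G T) (n * k)) (+-comm 1 ∣ S ∣) (dim (with-height-one h))) ,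
      (λ ∄h → dim (no-height-one ∄h)) }
  where
  dim : ∀ {k} → EdgeCoverNumber T k → LocalMetricDim (corona G T) (n * k)
  dim = Corona.local-metric-dim G T connected 2≤n (Tree.triangle-free T tree)
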